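{- Let $\mathcal C$ be a tidy LD category, $u\in\mathfrak Y$, $\vec A\in\mathcal C^{|u|}$, and $i$ an identity morphism of an $\otimes$-product. For every atomic morphism $h$ with target $H^i_u(\vec A)$, the composite $\tau^i_u(\vec A)\circ h$ is $\mathrm{Id}^\otimes$-analysable.
   Context: $\mathcal C$ is a unitless LD category: bifunctors $\otimes,\odot$ (no units), natural isomorphisms $\alpha_{A,B,C}:A\otimes(B\otimes C)\to(A\otimes B)\otimes C$, $\bar\alpha_{A,B,C}:A\odot(B\odot C)\to(A\odot B)\odot C$, natural transformations $\delta^l_{A,B,C}:A\otimes(B\odot C)\to(A\otimes B)\odot C$, $\delta^r_{A,B,C}:(A\odot B)\otimes C\to A\odot(B\otimes C)$, satisfying (objects denote identities): (P1) $\alpha_{A\otimes B,C,D}\circ\alpha_{A,B,C\otimes D}=(\alpha_{A,B,C}\otimes D)\circ\alpha_{A,B\otimes C,D}\circ(A\otimes\alpha_{B,C,D})$; (P2) $\delta^l_{A\otimes B,C,D}\circ\alpha_{A,B,C\odot D}=(\alpha_{A,B,C}\odot D)\circ\delta^l_{A,B\otimes C,D}\circ(A\otimes\delta^l_{B,C,D})$; (P3) $\delta^l_{A,B,C\otimes D}\circ(A\otimes\delta^r_{B,C,D})=\delta^r_{A\otimes B,C,D}\circ(\delta^l_{A,B,C}\otimes D)\circ\alpha_{A,B\odot C,D}$; (P4) $\bar\alpha_{A\otimes B,C,D}\circ\delta^l_{A,B,C\odot D}=(\delta^l_{A,B,C}\odot D)\circ\delta^l_{A,B\odot C,D}\circ(A\otimes\bar\alpha_{B,C,D})$;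 (P5) $(A\odot\alpha_{B,C,D})\circ\delta^r_{A,B,C\otimes D}=\delta^r_{A,B\otimes C,D}\circ(\delta^r_{A,B,C}\otimes D)\circ\alpha_{A\odot B,C,D}$; (P6) $(\delta^r_{A,B,C}\odot D)\circ\delta^l_{A\odot B,C,D}=\bar\alpha_{A,B\otimes C,D}\circ(A\odot\delta^l_{B,C,D})\circ\delta^r_{A,B,C\odot D}$; (P7) $\delta^r_{A\odot B,C,D}\circ(\bar\alpha_{A,B,C}\otimes D)=\bar\alpha_{A,B,C\otimes D}\circ(A\odot\delta^r_{B,C,D})\circ\delta^r_{A,B\odot C,D}$; (P8) $\bar\alpha_{A\odot B,C,D}\circ\bar\alpha_{A,B,C\odot D}=(\bar\alpha_{A,B,C}\odot D)\circ\bar\alpha_{A,B\odot C,D}\circ(A\odot\bar\alpha_{B,C,D})$. Tidy: $A_1\otimes A_2=B_1\otimes B_2\Rightarrow A_i=B_i$, same for $\odot$, and $A_1\otimes A_2\ne B_1\odot B_2$. Atomic morphisms: smallest class containing components of $\alpha^{\pm1},\bar\alpha^{\pm1},\delta^l,\delta^r$ and closed under $f\mapsto f\otimes\mathrm{id}_A,\mathrm{id}_A\otimes f,f\odot\mathrm{id}_A,\mathrm{id}_A\odot f$. $\mathrm{Id}^\otimes$ = class of identities of $\otimes$-products (objects $A_1\otimes A_2$). $\mathfrak Y$ = free monoid on letters $\alpha,\alpha^{ -1}$. For $f:H\to L\otimes R$, $u\in\mathfrak Y$: $H^f_\emptyset=H$, $L^f_\emptyset=L$, $R^f_\emptyset=R$;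 $H^f_{\alpha u}(\vec A)=A_1\otimes H^f_u(\vec A_{\ge2})$, $L^f_{\alpha u}(\vec A)=A_1\otimes L^f_u(\vec A_{\ge2})$, $R^f_{\alpha u}(\vec A)=R^f_u(\vec A_{\ge2})$; $H^f_{\alpha^{ -1}u}(\vec A)=H^f_u(\vec A_{\le|u|})\otimes A_{|u|+1}$, $L^f_{\alpha^{ -1}u}(\vec A)=L^f_u(\vec A_{\le|u|})$, $R^f_{\alpha^{ -1}u}(\vec A)=R^f_u(\vec A_{\le|u|})\otimes A_{|u|+1}$ (with $\vec A_{\ge k}=(A_k,\dots)$, $\vec A_{\le k}=(A_1,\dots,A_k)$); $\tau^f_\emptyset=f$, $\tau^f_{\alpha u}=\alpha\circ(\mathrm{id}\otimes\tau^f_u)$, $\tau^f_{\alpha^{ -1}u}=\alpha^{ -1}\circ(\tau^f_u\otimes\mathrm{id})$, natural transformations $H^f_u\to L^f_u\otimes R^f_u$. For a set $\mathfrak f$ of morphisms with $\otimes$-product targets, $g$ is $\mathfrak f$-analysable if $g=(g'\otimes g'')\circ\tau^f_v(\vec B)$ for some morphisms $g',g''$, $f\in\mathfrak f$, $v\in\mathfrak Y$, $\vec B\in\mathcal C^{|v|}$. -}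

module Defs where

open import Level using (Level; _⊔_; suc)
open import Data.List using (List; []; _∷_; length)
open import Data.Vec using (Vec; []; _∷_; init; last)
open import Data.Product using (Σ; _×_; _,_)
open import Relation.Binary.PropositionalEquality using (_≡_)
open import Relation.Nullary using (¬_)

-- Unitless LD categories (morphism equality is propositional equality)

record LDCat (o m : Level) : Set (suc (o ⊔ m)) where
  infixr 9 _∘_
  infixr 10 _⊗_ _⊙_ _⊗₁_ _⊙₁_
  field
    Obj : Set o
    Hom : Obj → Obj → Set m
    id  : ∀ {A} → Hom A A
    _∘_ : ∀ {A B C} → Hom B C → Hom A B → Hom A C
    identityˡ : ∀ {A B} (f : Hom A B) → id ∘ f ≡ f
    identityʳ : ∀ {A B} (f : Hom A B) → f ∘ id ≡ f
    assoc : ∀ {A B C D} (f : Hom C D) (g : Hom B C) (h : Hom A B) →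
            (f ∘ g) ∘ h ≡ f ∘ (g ∘ h)

    _⊗_ : Obj → Obj → Obj
    _⊗₁_ : ∀ {A B C D} → Hom A B → Hom C D → Hom (A ⊗ C) (B ⊗ D)
    ⊗-id : ∀ {A B} → id {A} ⊗₁ id {B} ≡ id
    ⊗-∘ : ∀ {A B C D E F} (f : Hom B C) (g : Hom A B) (h : Hom E F) (k : Hom D E) →
          (f ∘ g) ⊗₁ (h ∘ k) ≡ (f ⊗₁ h) ∘ (g ⊗₁ k)

    _⊙_ : Obj → Obj → Obj
    _⊙₁_ : ∀ {A B C D} → Hom A B → Hom C D → Hom (A ⊙ C) (B ⊙ D)
    ⊙-id : ∀ {A B} → id {A} ⊙₁ id {B} ≡ id
    ⊙-∘ : ∀ {A B C D E F} (f : Hom B C) (g : Hom A B) (h : Hom E F) (k : Hom D E) →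
          (f ∘ g) ⊙₁ (h ∘ k) ≡ (f ⊙₁ h) ∘ (g ⊙₁ k)

    α   : ∀ A B C → Hom (A ⊗ (B ⊗ C)) ((A ⊗ B) ⊗ C)
    α⁻¹ : ∀ A B C → Hom ((A ⊗ B) ⊗ C) (A ⊗ (B ⊗ C))
    α-isoˡ : ∀ A B C → α⁻¹ A B C ∘ α A B C ≡ id
    α-isoʳ : ∀ A B C → α A B C ∘ α⁻¹ A B C ≡ id
    α-nat : ∀ {A A' B B' C C'} (f : Hom A A') (g : Hom B B') (h : Hom C C') →
            α A' B' C' ∘ (f ⊗₁ (g ⊗₁ h)) ≡ ((f ⊗₁ g) ⊗₁ h) ∘ α A B C

    ᾱ   : ∀ A B C → Hom (A ⊙ (B ⊙ C)) ((A ⊙ B) ⊙ C)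
    ᾱ⁻¹ : ∀ A B C → Hom ((A ⊙ B) ⊙ C) (A ⊙ (B ⊙ C))
    ᾱ-isoˡ : ∀ A B C → ᾱ⁻¹ A B C ∘ ᾱ A B C ≡ id
    ᾱ-isoʳ : ∀ A B C → ᾱ A B C ∘ ᾱ⁻¹ A B C ≡ id
    ᾱ-nat : ∀ {A A' B B' C C'} (f : Hom A A') (g : Hom B B') (h : Hom C C') →
            ᾱ A' B' C' ∘ (f ⊙₁ (g ⊙₁ h)) ≡ ((f ⊙₁ g) ⊙₁ h) ∘ ᾱ A B C

    δˡ : ∀ A B C → Hom (A ⊗ (B ⊙ C)) ((A ⊗ B) ⊙ C)
    δʳ : ∀ A B C → Hom ((A ⊙ B) ⊗ C) (A ⊙ (B ⊗ C))
    δˡ-nat : ∀ {A A' B B' C C'} (f : Hom A A') (g : Hom B B') (h : Hom C C') →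
             δˡ A' B' C' ∘ (f ⊗₁ (g ⊙₁ h)) ≡ ((f ⊗₁ g) ⊙₁ h) ∘ δˡ A B C
    δʳ-nat : ∀ {A A' B B' C C'} (f : Hom A A') (g : Hom B B') (h : Hom C C') →
             δʳ A' B' C' ∘ ((f ⊙₁ g) ⊗₁ h) ≡ (f ⊙₁ (g ⊗₁ h)) ∘ δʳ A B C

    P1 : ∀ A B C D →
         α (A ⊗ B) C D ∘ α A B (C ⊗ D)
           ≡ (α A B C ⊗₁ id {D}) ∘ α A (B ⊗ C) D ∘ (id {A} ⊗₁ α B C D)
    P2 : ∀ A B C D →
         δˡ (A ⊗ B) C D ∘ α A B (C ⊙ D)
           ≡ (α A B C ⊙₁ id {D}) ∘ δˡ A (B ⊗ C) D ∘ (id {A} ⊗₁ δˡ B C D)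
    P3 : ∀ A B C D →
         δˡ A B (C ⊗ D) ∘ (id {A} ⊗₁ δʳ B C D)
           ≡ δʳ (A ⊗ B) C D ∘ (δˡ A B C ⊗₁ id {D}) ∘ α A (B ⊙ C) D
    P4 : ∀ A B C D →
         ᾱ (A ⊗ B) C D ∘ δˡ A B (C ⊙ D)
           ≡ (δˡ A B C ⊙₁ id {D}) ∘ δˡ A (B ⊙ C) D ∘ (id {A} ⊗₁ ᾱ B C D)
    P5 : ∀ A B C D →
         (id {A} ⊙₁ α B C D) ∘ δʳ A B (C ⊗ D)
           ≡ δʳ A (B ⊗ C) D ∘ (δʳ A B C ⊗₁ id {D}) ∘ α (A ⊙ B) C D
    P6 : ∀ A B C D →
         (δʳ A B C ⊙₁ id {D}) ∘ δˡ (A ⊙ B) C D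
           ≡ ᾱ A (B ⊗ C) D ∘ (id {A} ⊙₁ δˡ B C D) ∘ δʳ A B (C ⊙ D)
    P7 : ∀ A B C D →
         δʳ (A ⊙ B) C D ∘ (ᾱ A B C ⊗₁ id {D})
           ≡ ᾱ A B (C ⊗ D) ∘ (id {A} ⊙₁ δʳ B C D) ∘ δʳ A (B ⊙ C) D
    P8 : ∀ A B C D →
         ᾱ (A ⊙ B) C D ∘ ᾱ A B (C ⊙ D)
           ≡ (ᾱ A B C ⊙₁ id {D}) ∘ ᾱ A (B ⊙ C) D ∘ (id {A} ⊙₁ ᾱ B C D)

module _ {o m : Level} (𝒞 : LDCat o m) where
  open LDCat 𝒞

  Tidy : Set o
  Tidy = (∀ {A₁ A₂ B₁ B₂} → A₁ ⊗ A₂ ≡ B₁ ⊗ B₂ → (A₁ ≡ B₁) × (A₂ ≡ B₂))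
       × (∀ {A₁ A₂ B₁ B₂} → A₁ ⊙ A₂ ≡ B₁ ⊙ B₂ → (A₁ ≡ B₁) × (A₂ ≡ B₂))
       × (∀ {A₁ A₂ B₁ B₂} → ¬ (A₁ ⊗ A₂ ≡ B₁ ⊙ B₂))

  data Atomic : ∀ {X Y} → Hom X Y → Set (o ⊔ m) where
    at-α   : ∀ A B C → Atomic (α A B C)
    at-α⁻¹ : ∀ A B C → Atomic (α⁻¹ A B C)
    at-ᾱ   : ∀ A B C → Atomic (ᾱ A B C)
    at-ᾱ⁻¹ : ∀ A B C → Atomic (ᾱ⁻¹ A B C)
    at-δˡ  : ∀ A B C → Atomic (δˡ A B C)
    at-δʳ  : ∀ A B C → Atomic (δʳ A B C)
    at-⊗ˡ  : ∀ {X Y} {f : Hom X Y} (A : Obj) → Atomic f → Atomic (f ⊗₁ id {A})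
    at-⊗ʳ  : ∀ {X Y} {f : Hom X Y} (A : Obj) → Atomic f → Atomic (id {A} ⊗₁ f)
    at-⊙ˡ  : ∀ {X Y} {f : Hom X Y} (A : Obj) → Atomic f → Atomic (f ⊙₁ id {A})
    at-⊙ʳ  : ∀ {X Y} {f : Hom X Y} (A : Obj) → Atomic f → Atomic (id {A} ⊙₁ f)

  data Id⊗ : ∀ {H L R} → Hom H (L ⊗ R) → Set (o ⊔ m) where
    id⊗ : ∀ L R → Id⊗ (id {L ⊗ R})

data Letter : Set where
  aα aα⁻¹ : Letter

𝔜 : Set
𝔜 = List Letter

module _ {o m : Level} (𝒞 : LDCat o m) where
  open LDCat 𝒞

  -- H^f_u, L^f_u, R^f_u (depending only on H, L, R of f : H → L ⊗ R)
  Hᵘ Lᵘ Rᵘ : (H L R : Obj) (u : 𝔜) → Vec Obj (length u) → Obj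
  Hᵘ H L R [] [] = H
  Hᵘ H L R (aα ∷ u) (A ∷ As) = A ⊗ Hᵘ H L R u As
  Hᵘ H L R (aα⁻¹ ∷ u) As = Hᵘ H L R u (init As) ⊗ last As
  Lᵘ H L R [] [] = L
  Lᵘ H L R (aα ∷ u) (A ∷ As) = A ⊗ Lᵘ H L R u As
  Lᵘ H L R (aα⁻¹ ∷ u) As = Lᵘ H L R u (init As)
  Rᵘ H L R [] [] = R
  Rᵘ H L R (aα ∷ u) (A ∷ As) = Rᵘ H L R u As
  Rᵘ H L R (aα⁻¹ ∷ u) As = Rᵘ H L R u (init As) ⊗ last As

  τ : ∀ {H L R} (f : Hom H (L ⊗ R)) (u : 𝔜) (As : Vec Obj (length u)) →
      Hom (Hᵘ H L R u As) (Lᵘ H L R u As ⊗ Rᵘ H L R u As)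
  τ f [] [] = f
  τ {H} {L} {R} f (aα ∷ u) (A ∷ As) =
    α A (Lᵘ H L R u As) (Rᵘ H L R u As) ∘ (id {A} ⊗₁ τ f u As)
  τ {H} {L} {R} f (aα⁻¹ ∷ u) As =
    α⁻¹ (Lᵘ H L R u (init As)) (Rᵘ H L R u (init As)) (last As)
      ∘ (τ f u (init As) ⊗₁ id {last As})

  data Analysable (𝔣 : ∀ {H L R} → Hom H (L ⊗ R) → Set (o ⊔ m))
       : ∀ {X Y} → Hom X Y → Set (suc (o ⊔ m)) where
    analysed : ∀ {H L R} (f : Hom H (L ⊗ R)) → 𝔣 f →
               (v : 𝔜) (B : Vec Obj (length v)) {W₁ W₂ : Obj}
               (g' : Hom (Lᵘ H L R v B) W₁) (g'' : Hom (Rᵘ H L R v B) W₂)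
               (g : Hom (Hᵘ H L R v B) (W₁ ⊗ W₂)) →
               g ≡ (g' ⊗₁ g'') ∘ τ f v B → Analysable 𝔣 g

module Submission where

-- Tidiness makes H^i_u(A) a ⊗-product, so an atomic h into it is α, α⁻¹,
-- f ⊗ id or id ⊗ f.  Write τ_{αu} = A ◁ τ_u and τ_{α⁻¹u} = τ_u ▷ Z.  By
-- naturality of α and the pentagon, each composite τ_u ∘ h equals
-- (g₁ ⊗ g₂) ∘ t, where t is built from some τ_v by ◁ and ▷, or from τ_v ∘ f
-- for the atomic f inside h (the inductive case).  Id⊗-analyses are stable
-- under ◁, ▷ and postcomposition with g₁ ⊗ g₂.

open import Defs
open import Level using (Level; _⊔_)
open import Data.List using (length; []; _∷_)
open import Data.Vec using (Vec; []; _∷_; init; last; _∷ʳ_)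
open import Data.Vec.Properties using (init-∷ʳ; last-∷ʳ)
open import Data.Product using (_×_; _,_; proj₁; proj₂)
open import Data.Empty using (⊥-elim)
open import Relation.Nullary using (¬_)
open import Relation.Binary.PropositionalEquality

module Extensions {o m : Level} (𝒞 : LDCat o m) where
  open LDCat 𝒞
  open ≡-Reasoning

  cancelˡ : ∀ {A B C} {f : Hom A B} {g : Hom B A} (h : Hom C A) → g ∘ f ≡ id → g ∘ (f ∘ h) ≡ h
  cancelˡ {f = f} {g} h gf = begin
    g ∘ (f ∘ h)  ≡⟨ sym (assoc g f h) ⟩
    (g ∘ f) ∘ h  ≡⟨ cong (_∘ h) gf ⟩
    id ∘ h       ≡⟨ identityˡ h ⟩
    h            ∎

  extendˡ : ∀ {A B C D E} {a : Hom C E} {b : Hom B C} {c : Hom D E} {d : Hom B D} {f : Hom A B} →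
            a ∘ b ≡ c ∘ d → a ∘ (b ∘ f) ≡ c ∘ (d ∘ f)
  extendˡ {a = a} {b} {c} {d} {f} sq = begin
    a ∘ (b ∘ f)  ≡⟨ sym (assoc a b f) ⟩
    (a ∘ b) ∘ f  ≡⟨ cong (_∘ f) sq ⟩
    (c ∘ d) ∘ f  ≡⟨ assoc c d f ⟩
    c ∘ (d ∘ f)  ∎

  inverse-unique : ∀ {A B} {f : Hom A B} {g h : Hom B A} → g ∘ f ≡ id → f ∘ h ≡ id → g ≡ h
  inverse-unique {f = f} {g} {h} gf fh = begin
    g            ≡⟨ sym (identityʳ g) ⟩
    g ∘ id       ≡⟨ cong (g ∘_) (sym fh) ⟩
    g ∘ (f ∘ h)  ≡⟨ cancelˡ h gf ⟩
    h            ∎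

  invert-square : ∀ {A B C D} {f : Hom C D} {f⁻ : Hom D C} {g : Hom A B} {g⁻ : Hom B A}
                  {a : Hom A C} {b : Hom B D} →
                  f⁻ ∘ f ≡ id → g ∘ g⁻ ≡ id → f ∘ a ≡ b ∘ g → a ∘ g⁻ ≡ f⁻ ∘ b
  invert-square {f = f} {f⁻} {g} {g⁻} {a} {b} f⁻f gg⁻ sq = begin
    a ∘ g⁻               ≡⟨ sym (cancelˡ _ f⁻f) ⟩
    f⁻ ∘ (f ∘ (a ∘ g⁻))  ≡⟨ cong (f⁻ ∘_) (extendˡ sq) ⟩
    f⁻ ∘ (b ∘ (g ∘ g⁻))  ≡⟨ cong (λ k → f⁻ ∘ (b ∘ k)) gg⁻ ⟩
    f⁻ ∘ (b ∘ id)        ≡⟨ cong (f⁻ ∘_) (identityʳ b) ⟩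
    f⁻ ∘ b               ∎

  id⊗-∘ : ∀ {A B C D} {f : Hom B C} {g : Hom A B} → (id {D} ⊗₁ f) ∘ (id ⊗₁ g) ≡ id ⊗₁ (f ∘ g)
  id⊗-∘ {f = f} {g} = trans (sym (⊗-∘ id id f g)) (cong (_⊗₁ (f ∘ g)) (identityˡ id))

  ⊗id-∘ : ∀ {A B C D} {f : Hom B C} {g : Hom A B} → (f ⊗₁ id {D}) ∘ (g ⊗₁ id) ≡ (f ∘ g) ⊗₁ id
  ⊗id-∘ {f = f} {g} = trans (sym (⊗-∘ f g id id)) (cong ((f ∘ g) ⊗₁_) (identityˡ id))

  id⊗-inverse : ∀ {A B C} {f : Hom A B} {g : Hom B A} → g ∘ f ≡ id → (id {C} ⊗₁ g) ∘ (id ⊗₁ f) ≡ id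
  id⊗-inverse gf = trans id⊗-∘ (trans (cong (id ⊗₁_) gf) ⊗-id)

  ⊗id-inverse : ∀ {A B C} {f : Hom A B} {g : Hom B A} → g ∘ f ≡ id → (g ⊗₁ id {C}) ∘ (f ⊗₁ id) ≡ id
  ⊗id-inverse gf = trans ⊗id-∘ (trans (cong (_⊗₁ id) gf) ⊗-id)

  ⊗-interchange : ∀ {A B C D} (f : Hom A B) (g : Hom C D) → (f ⊗₁ id) ∘ (id ⊗₁ g) ≡ (id ⊗₁ g) ∘ (f ⊗₁ id)
  ⊗-interchange f g = begin
    (f ⊗₁ id) ∘ (id ⊗₁ g)  ≡⟨ sym (⊗-∘ f id id g) ⟩
    (f ∘ id) ⊗₁ (id ∘ g)   ≡⟨ cong₂ _⊗₁_ (trans (identityʳ f) (sym (identityˡ f)))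
                                          (trans (identityˡ g) (sym (identityʳ g))) ⟩
    (id ∘ f) ⊗₁ (g ∘ id)   ≡⟨ ⊗-∘ id f g id ⟩
    (id ⊗₁ g) ∘ (f ⊗₁ id)  ∎

  α⁻¹-nat : ∀ {A A′ B B′ C C′} (f : Hom A A′) (g : Hom B B′) (h : Hom C C′) →
            α⁻¹ A′ B′ C′ ∘ ((f ⊗₁ g) ⊗₁ h) ≡ (f ⊗₁ (g ⊗₁ h)) ∘ α⁻¹ A B C
  α⁻¹-nat f g h = sym (invert-square (α-isoˡ _ _ _) (α-isoʳ _ _ _) (α-nat f g h))

  pentagon⁻¹ : ∀ A B C D →
               α⁻¹ A B (C ⊗ D) ∘ α⁻¹ (A ⊗ B) C D
                 ≡ (id {A} ⊗₁ α⁻¹ B C D) ∘ α⁻¹ A (B ⊗ C) D ∘ (α⁻¹ A B C ⊗₁ id {D})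
  pentagon⁻¹ A B C D = inverse-unique left right
    where
    left : (α⁻¹ A B (C ⊗ D) ∘ α⁻¹ (A ⊗ B) C D) ∘ (α (A ⊗ B) C D ∘ α A B (C ⊗ D)) ≡ id
    left = trans (assoc _ _ _)
                 (trans (cong (α⁻¹ A B (C ⊗ D) ∘_) (cancelˡ _ (α-isoˡ _ _ _))) (α-isoˡ _ _ _))
    right : (α (A ⊗ B) C D ∘ α A B (C ⊗ D))
              ∘ ((id ⊗₁ α⁻¹ B C D) ∘ α⁻¹ A (B ⊗ C) D ∘ (α⁻¹ A B C ⊗₁ id)) ≡ id
    right = begin
      (α (A ⊗ B) C D ∘ α A B (C ⊗ D)) ∘ ((id ⊗₁ α⁻¹ B C D) ∘ α⁻¹ A (B ⊗ C) D ∘ (α⁻¹ A B C ⊗₁ id))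
        ≡⟨ cong (_∘ ((id ⊗₁ α⁻¹ B C D) ∘ α⁻¹ A (B ⊗ C) D ∘ (α⁻¹ A B C ⊗₁ id))) (P1 A B C D) ⟩
      ((α A B C ⊗₁ id) ∘ α A (B ⊗ C) D ∘ (id ⊗₁ α B C D))
        ∘ ((id ⊗₁ α⁻¹ B C D) ∘ α⁻¹ A (B ⊗ C) D ∘ (α⁻¹ A B C ⊗₁ id))
        ≡⟨ trans (assoc _ _ _) (cong ((α A B C ⊗₁ id) ∘_) (assoc _ _ _)) ⟩
      (α A B C ⊗₁ id) ∘ α A (B ⊗ C) D ∘ (id ⊗₁ α B C D)
        ∘ (id ⊗₁ α⁻¹ B C D) ∘ α⁻¹ A (B ⊗ C) D ∘ (α⁻¹ A B C ⊗₁ id)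
        ≡⟨ cong (λ k → (α A B C ⊗₁ id) ∘ α A (B ⊗ C) D ∘ k) (cancelˡ _ (id⊗-inverse (α-isoʳ B C D))) ⟩
      (α A B C ⊗₁ id) ∘ α A (B ⊗ C) D ∘ α⁻¹ A (B ⊗ C) D ∘ (α⁻¹ A B C ⊗₁ id)
        ≡⟨ cong ((α A B C ⊗₁ id) ∘_) (cancelˡ _ (α-isoʳ _ _ _)) ⟩
      (α A B C ⊗₁ id) ∘ (α⁻¹ A B C ⊗₁ id)
        ≡⟨ ⊗id-inverse (α-isoʳ A B C) ⟩
      id ∎

  -- τ f (aα ∷ u) (A ∷ As) is definitionally A ◁ τ f u As, and
  -- τ f (aα⁻¹ ∷ u) As is τ f u (init As) ▷ last As.
  _◁_ : ∀ A {H L R} → Hom H (L ⊗ R) → Hom (A ⊗ H) ((A ⊗ L) ⊗ R)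
  A ◁ t = α A _ _ ∘ (id ⊗₁ t)

  _▷_ : ∀ {H L R} → Hom H (L ⊗ R) → ∀ Z → Hom (H ⊗ Z) (L ⊗ (R ⊗ Z))
  t ▷ Z = α⁻¹ _ _ Z ∘ (t ⊗₁ id)

  ◁-id : ∀ A B C → A ◁ id {B ⊗ C} ≡ α A B C
  ◁-id A B C = trans (cong (α A B C ∘_) ⊗-id) (identityʳ _)

  ▷-id : ∀ A B C → id {A ⊗ B} ▷ C ≡ α⁻¹ A B C
  ▷-id A B C = trans (cong (α⁻¹ A B C ∘_) ⊗-id) (identityʳ _)

  ◁-⊗∘ : ∀ {A H L R L′ R′} {t : Hom H (L ⊗ R)} (g₁ : Hom L L′) (g₂ : Hom R R′) →
         A ◁ ((g₁ ⊗₁ g₂) ∘ t) ≡ ((id ⊗₁ g₁) ⊗₁ g₂) ∘ (A ◁ t)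
  ◁-⊗∘ g₁ g₂ = trans (cong (α _ _ _ ∘_) (sym id⊗-∘)) (extendˡ (α-nat id g₁ g₂))

  ▷-⊗∘ : ∀ {Z H L R L′ R′} {t : Hom H (L ⊗ R)} (g₁ : Hom L L′) (g₂ : Hom R R′) →
         ((g₁ ⊗₁ g₂) ∘ t) ▷ Z ≡ (g₁ ⊗₁ (g₂ ⊗₁ id)) ∘ (t ▷ Z)
  ▷-⊗∘ g₁ g₂ = trans (cong (α⁻¹ _ _ _ ∘_) (sym ⊗id-∘)) (extendˡ (α⁻¹-nat g₁ g₂ id))

  ◁-∘-id⊗ : ∀ {A H L R X} {t : Hom H (L ⊗ R)} (f : Hom X H) → (A ◁ t) ∘ (id ⊗₁ f) ≡ A ◁ (t ∘ f)
  ◁-∘-id⊗ f = trans (assoc _ _ _) (cong (α _ _ _ ∘_) id⊗-∘)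

  ▷-∘-⊗id : ∀ {Z H L R X} {t : Hom H (L ⊗ R)} (f : Hom X H) → (t ▷ Z) ∘ (f ⊗₁ id) ≡ (t ∘ f) ▷ Z
  ▷-∘-⊗id f = trans (assoc _ _ _) (cong (α⁻¹ _ _ _ ∘_) ⊗id-∘)

  ◁-∘-⊗id : ∀ {A A′ H L R} {t : Hom H (L ⊗ R)} (f : Hom A A′) →
            (A′ ◁ t) ∘ (f ⊗₁ id) ≡ ((f ⊗₁ id) ⊗₁ id) ∘ (A ◁ t)
  ◁-∘-⊗id {t = t} f = begin
    (α _ _ _ ∘ (id ⊗₁ t)) ∘ (f ⊗₁ id)  ≡⟨ assoc _ _ _ ⟩
    α _ _ _ ∘ (id ⊗₁ t) ∘ (f ⊗₁ id)    ≡⟨ cong (α _ _ _ ∘_) (sym (⊗-interchange f t)) ⟩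
    α _ _ _ ∘ (f ⊗₁ id) ∘ (id ⊗₁ t)    ≡⟨ cong (λ k → α _ _ _ ∘ (f ⊗₁ k) ∘ (id ⊗₁ t)) (sym ⊗-id) ⟩
    α _ _ _ ∘ (f ⊗₁ (id ⊗₁ id)) ∘ (id ⊗₁ t)  ≡⟨ extendˡ (α-nat f id id) ⟩
    ((f ⊗₁ id) ⊗₁ id) ∘ α _ _ _ ∘ (id ⊗₁ t)  ∎

  ▷-∘-id⊗ : ∀ {Z Z′ H L R} {t : Hom H (L ⊗ R)} (f : Hom Z Z′) →
            (t ▷ Z′) ∘ (id ⊗₁ f) ≡ (id ⊗₁ (id ⊗₁ f)) ∘ (t ▷ Z)
  ▷-∘-id⊗ {t = t} f = begin
    (α⁻¹ _ _ _ ∘ (t ⊗₁ id)) ∘ (id ⊗₁ f)  ≡⟨ assoc _ _ _ ⟩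
    α⁻¹ _ _ _ ∘ (t ⊗₁ id) ∘ (id ⊗₁ f)    ≡⟨ cong (α⁻¹ _ _ _ ∘_) (⊗-interchange t f) ⟩
    α⁻¹ _ _ _ ∘ (id ⊗₁ f) ∘ (t ⊗₁ id)    ≡⟨ cong (λ k → α⁻¹ _ _ _ ∘ (k ⊗₁ f) ∘ (t ⊗₁ id)) (sym ⊗-id) ⟩
    α⁻¹ _ _ _ ∘ ((id ⊗₁ id) ⊗₁ f) ∘ (t ⊗₁ id)  ≡⟨ extendˡ (α⁻¹-nat id id f) ⟩
    (id ⊗₁ (id ⊗₁ f)) ∘ α⁻¹ _ _ _ ∘ (t ⊗₁ id)  ∎

  ◁-∘-α : ∀ X Y {H L R} (t : Hom H (L ⊗ R)) →
          ((X ⊗ Y) ◁ t) ∘ α X Y H ≡ (α X Y L ⊗₁ id) ∘ (X ◁ (Y ◁ t))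
  ◁-∘-α X Y {H} {L} {R} t = begin
    (α (X ⊗ Y) L R ∘ (id ⊗₁ t)) ∘ α X Y H
      ≡⟨ assoc _ _ _ ⟩
    α (X ⊗ Y) L R ∘ (id ⊗₁ t) ∘ α X Y H
      ≡⟨ cong (λ k → α (X ⊗ Y) L R ∘ (k ⊗₁ t) ∘ α X Y H) (sym ⊗-id) ⟩
    α (X ⊗ Y) L R ∘ ((id ⊗₁ id) ⊗₁ t) ∘ α X Y H
      ≡⟨ cong (α (X ⊗ Y) L R ∘_) (sym (α-nat id id t)) ⟩
    α (X ⊗ Y) L R ∘ α X Y (L ⊗ R) ∘ (id ⊗₁ (id ⊗₁ t))
      ≡⟨ sym (assoc _ _ _) ⟩
    (α (X ⊗ Y) L R ∘ α X Y (L ⊗ R)) ∘ (id ⊗₁ (id ⊗₁ t))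
      ≡⟨ cong (_∘ (id ⊗₁ (id ⊗₁ t))) (P1 X Y L R) ⟩
    ((α X Y L ⊗₁ id) ∘ α X (Y ⊗ L) R ∘ (id ⊗₁ α Y L R)) ∘ (id ⊗₁ (id ⊗₁ t))
      ≡⟨ trans (assoc _ _ _)
               (cong ((α X Y L ⊗₁ id) ∘_) (trans (assoc _ _ _) (cong (α X (Y ⊗ L) R ∘_) id⊗-∘))) ⟩
    (α X Y L ⊗₁ id) ∘ α X (Y ⊗ L) R ∘ (id ⊗₁ (α Y L R ∘ (id ⊗₁ t)))
      ∎

  ◁◁-∘-α⁻¹ : ∀ X Y {H L R} (t : Hom H (L ⊗ R)) →
             (X ◁ (Y ◁ t)) ∘ α⁻¹ X Y H ≡ (α⁻¹ X Y L ⊗₁ id) ∘ ((X ⊗ Y) ◁ t)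
  ◁◁-∘-α⁻¹ X Y {H} {L} t =
    invert-square (⊗id-inverse (α-isoˡ X Y L)) (α-isoʳ X Y H) (sym (◁-∘-α X Y t))

  ▷-∘-α⁻¹ : ∀ {H L R} (t : Hom H (L ⊗ R)) Y Z →
            (t ▷ (Y ⊗ Z)) ∘ α⁻¹ H Y Z ≡ (id ⊗₁ α⁻¹ R Y Z) ∘ ((t ▷ Y) ▷ Z)
  ▷-∘-α⁻¹ {H} {L} {R} t Y Z = begin
    (α⁻¹ L R (Y ⊗ Z) ∘ (t ⊗₁ id)) ∘ α⁻¹ H Y Z
      ≡⟨ assoc _ _ _ ⟩
    α⁻¹ L R (Y ⊗ Z) ∘ (t ⊗₁ id) ∘ α⁻¹ H Y Z
      ≡⟨ cong (λ k → α⁻¹ L R (Y ⊗ Z) ∘ (t ⊗₁ k) ∘ α⁻¹ H Y Z) (sym ⊗-id) ⟩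
    α⁻¹ L R (Y ⊗ Z) ∘ (t ⊗₁ (id ⊗₁ id)) ∘ α⁻¹ H Y Z
      ≡⟨ cong (α⁻¹ L R (Y ⊗ Z) ∘_) (sym (α⁻¹-nat t id id)) ⟩
    α⁻¹ L R (Y ⊗ Z) ∘ α⁻¹ (L ⊗ R) Y Z ∘ ((t ⊗₁ id) ⊗₁ id)
      ≡⟨ sym (assoc _ _ _) ⟩
    (α⁻¹ L R (Y ⊗ Z) ∘ α⁻¹ (L ⊗ R) Y Z) ∘ ((t ⊗₁ id) ⊗₁ id)
      ≡⟨ cong (_∘ ((t ⊗₁ id) ⊗₁ id)) (pentagon⁻¹ L R Y Z) ⟩
    ((id ⊗₁ α⁻¹ R Y Z) ∘ α⁻¹ L (R ⊗ Y) Z ∘ (α⁻¹ L R Y ⊗₁ id)) ∘ ((t ⊗₁ id) ⊗₁ id)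
      ≡⟨ trans (assoc _ _ _)
               (cong ((id ⊗₁ α⁻¹ R Y Z) ∘_) (trans (assoc _ _ _) (cong (α⁻¹ L (R ⊗ Y) Z ∘_) ⊗id-∘))) ⟩
    (id ⊗₁ α⁻¹ R Y Z) ∘ α⁻¹ L (R ⊗ Y) Z ∘ ((α⁻¹ L R Y ∘ (t ⊗₁ id)) ⊗₁ id)
      ∎

  ▷▷-∘-α : ∀ {H L R} (t : Hom H (L ⊗ R)) Y Z →
           ((t ▷ Y) ▷ Z) ∘ α H Y Z ≡ (id ⊗₁ α R Y Z) ∘ (t ▷ (Y ⊗ Z))
  ▷▷-∘-α {H} {R = R} t Y Z =
    invert-square (id⊗-inverse (α-isoʳ R Y Z)) (α-isoˡ H Y Z) (sym (▷-∘-α⁻¹ t Y Z))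

  ◁▷-assoc : ∀ X {H L R} (t : Hom H (L ⊗ R)) Z →
             α (X ⊗ L) R Z ∘ (X ◁ (t ▷ Z)) ≡ ((X ◁ t) ⊗₁ id) ∘ α X H Z
  ◁▷-assoc X {H} {L} {R} t Z = begin
    α (X ⊗ L) R Z ∘ α X L (R ⊗ Z) ∘ (id ⊗₁ (α⁻¹ L R Z ∘ (t ⊗₁ id)))
      ≡⟨ sym (assoc _ _ _) ⟩
    (α (X ⊗ L) R Z ∘ α X L (R ⊗ Z)) ∘ (id ⊗₁ (α⁻¹ L R Z ∘ (t ⊗₁ id)))
      ≡⟨ cong (_∘ (id ⊗₁ (α⁻¹ L R Z ∘ (t ⊗₁ id)))) (P1 X L R Z) ⟩
    ((α X L R ⊗₁ id) ∘ α X (L ⊗ R) Z ∘ (id ⊗₁ α L R Z)) ∘ (id ⊗₁ (α⁻¹ L R Z ∘ (t ⊗₁ id)))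
      ≡⟨ trans (assoc _ _ _) (cong ((α X L R ⊗₁ id) ∘_) (assoc _ _ _)) ⟩
    (α X L R ⊗₁ id) ∘ α X (L ⊗ R) Z ∘ (id ⊗₁ α L R Z) ∘ (id ⊗₁ (α⁻¹ L R Z ∘ (t ⊗₁ id)))
      ≡⟨ cong (λ k → (α X L R ⊗₁ id) ∘ α X (L ⊗ R) Z ∘ k)
              (trans id⊗-∘ (cong (id ⊗₁_) (cancelˡ _ (α-isoʳ L R Z)))) ⟩
    (α X L R ⊗₁ id) ∘ α X (L ⊗ R) Z ∘ (id ⊗₁ (t ⊗₁ id))
      ≡⟨ cong ((α X L R ⊗₁ id) ∘_) (α-nat id t id) ⟩
    (α X L R ⊗₁ id) ∘ ((id ⊗₁ t) ⊗₁ id) ∘ α X H Z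
      ≡⟨ trans (sym (assoc _ _ _)) (cong (_∘ α X H Z) ⊗id-∘) ⟩
    ((α X L R ∘ (id ⊗₁ t)) ⊗₁ id) ∘ α X H Z
      ∎

  ▷◁-∘-α⁻¹ : ∀ X {H L R} (t : Hom H (L ⊗ R)) Z → (X ◁ (t ▷ Z)) ∘ α⁻¹ X H Z ≡ (X ◁ t) ▷ Z
  ▷◁-∘-α⁻¹ X t Z = invert-square (α-isoˡ _ _ _) (α-isoʳ _ _ _) (◁▷-assoc X t Z)

  ◁▷-∘-α : ∀ X {H L R} (t : Hom H (L ⊗ R)) Z → ((X ◁ t) ▷ Z) ∘ α X H Z ≡ X ◁ (t ▷ Z)
  ◁▷-∘-α X t Z = begin
    (α⁻¹ _ _ Z ∘ ((X ◁ t) ⊗₁ id)) ∘ α X _ Z  ≡⟨ assoc _ _ _ ⟩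
    α⁻¹ _ _ Z ∘ ((X ◁ t) ⊗₁ id) ∘ α X _ Z    ≡⟨ cong (α⁻¹ _ _ Z ∘_) (sym (◁▷-assoc X t Z)) ⟩
    α⁻¹ _ _ Z ∘ α _ _ Z ∘ (X ◁ (t ▷ Z))      ≡⟨ cancelˡ _ (α-isoˡ _ _ _) ⟩
    X ◁ (t ▷ Z)                              ∎

module IdAnalyses {o m : Level} (𝒞 : LDCat o m) where
  open LDCat 𝒞
  open Extensions 𝒞

  Hⁱ Lⁱ Rⁱ : (L R : Obj) (u : 𝔜) → Vec Obj (length u) → Obj
  Hⁱ L R = Hᵘ 𝒞 (L ⊗ R) L R
  Lⁱ L R = Lᵘ 𝒞 (L ⊗ R) L R
  Rⁱ L R = Rᵘ 𝒞 (L ⊗ R) L R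

  τⁱ : ∀ {L R} u As → Hom (Hⁱ L R u As) (Lⁱ L R u As ⊗ Rⁱ L R u As)
  τⁱ {L} {R} = τ 𝒞 (id {L ⊗ R})

  -- Analysable 𝒞 (Id⊗ 𝒞) with the target split as W₁ ⊗ W₂ beforehand, so that
  -- its witnesses can be matched on (⊗ is not a constructor).
  data IdAnalysis {W₁ W₂ : Obj} : ∀ {X} → Hom X (W₁ ⊗ W₂) → Set (o ⊔ m) where
    analysed : ∀ L R v B (g₁ : Hom (Lⁱ L R v B) W₁) (g₂ : Hom (Rⁱ L R v B) W₂) {g} →
               g ≡ (g₁ ⊗₁ g₂) ∘ τⁱ v B → IdAnalysis g

  analysable : ∀ {X W₁ W₂} {g : Hom X (W₁ ⊗ W₂)} → IdAnalysis g → Analysable 𝒞 (Id⊗ 𝒞) g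
  analysable (analysed L R v B g₁ g₂ g≡) = analysed id (id⊗ L R) v B g₁ g₂ _ g≡

  analysis-via : ∀ {X W₁ W₂} {g g′ : Hom X (W₁ ⊗ W₂)} → g ≡ g′ → IdAnalysis g′ → IdAnalysis g
  analysis-via g≡g′ = subst IdAnalysis (sym g≡g′)

  analysis-τ : ∀ {L R} u As → IdAnalysis (τⁱ {L} {R} u As)
  analysis-τ {L} {R} u As =
    analysed L R u As id id (sym (trans (cong (_∘ τⁱ u As) ⊗-id) (identityˡ _)))

  analysis-⊗∘ : ∀ {X W₁ W₂ V₁ V₂} {g : Hom X (W₁ ⊗ W₂)} (k₁ : Hom W₁ V₁) (k₂ : Hom W₂ V₂) →
                IdAnalysis g → IdAnalysis ((k₁ ⊗₁ k₂) ∘ g)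
  analysis-⊗∘ k₁ k₂ (analysed L R v B g₁ g₂ g≡) =
    analysed L R v B (k₁ ∘ g₁) (k₂ ∘ g₂)
      (trans (cong ((k₁ ⊗₁ k₂) ∘_) g≡)
             (trans (sym (assoc _ _ _)) (cong (_∘ τⁱ v B) (sym (⊗-∘ k₁ g₁ k₂ g₂)))))

  analysis-◁ : ∀ A {X W₁ W₂} {g : Hom X (W₁ ⊗ W₂)} → IdAnalysis g → IdAnalysis (A ◁ g)
  analysis-◁ A (analysed L R v B g₁ g₂ g≡) =
    analysed L R (aα ∷ v) (A ∷ B) (id ⊗₁ g₁) g₂ (trans (cong (A ◁_) g≡) (◁-⊗∘ g₁ g₂))

  analysis-▷ : ∀ Z {X W₁ W₂} {g : Hom X (W₁ ⊗ W₂)} → IdAnalysis g → IdAnalysis (g ▷ Z)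
  analysis-▷ Z (analysed L R v B g₁ g₂ g≡) with B ∷ʳ Z | init-∷ʳ Z B | last-∷ʳ Z B
  ... | B′ | refl | refl =
    analysed L R (aα⁻¹ ∷ v) B′ g₁ (g₂ ⊗₁ id) (trans (cong (_▷ Z) g≡) (▷-⊗∘ g₁ g₂))

module AtomicComposites {o m : Level} (𝒞 : LDCat o m) where
  open LDCat 𝒞
  open Extensions 𝒞
  open IdAnalyses 𝒞

  data AtomicInto⊗ : ∀ {X Y} → Hom X Y → Set (o ⊔ m) where
    α-atom   : ∀ A B C → AtomicInto⊗ (α A B C)
    α⁻¹-atom : ∀ A B C → AtomicInto⊗ (α⁻¹ A B C)
    ⊗ˡ-atom  : ∀ {X Y} {f : Hom X Y} A → Atomic 𝒞 f → AtomicInto⊗ (f ⊗₁ id {A})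
    ⊗ʳ-atom  : ∀ {X Y} {f : Hom X Y} A → Atomic 𝒞 f → AtomicInto⊗ (id {A} ⊗₁ f)

  -- Below, the target of h is passed as an equation e, since Atomic cannot be
  -- matched at a stuck target such as Hⁱ L R u As; once tidiness has reduced e
  -- to a loop, matching it against refl (K) removes the transport.
  module _ (⊗-injective : ∀ {A B C D} → A ⊗ B ≡ C ⊗ D → (A ≡ C) × (B ≡ D))
           (⊗≢⊙ : ∀ {A B C D} → ¬ (A ⊗ B ≡ C ⊙ D)) where

    atomic-into-⊗ : ∀ {X Y P Q} {h : Hom X Y} → Atomic 𝒞 h → Y ≡ P ⊗ Q → AtomicInto⊗ h
    atomic-into-⊗ (at-α A B C)    _ = α-atom A B C
    atomic-into-⊗ (at-α⁻¹ A B C)  _ = α⁻¹-atom A B C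
    atomic-into-⊗ (at-⊗ˡ A f)     _ = ⊗ˡ-atom A f
    atomic-into-⊗ (at-⊗ʳ A f)     _ = ⊗ʳ-atom A f
    atomic-into-⊗ (at-ᾱ _ _ _)   e = ⊥-elim (⊗≢⊙ (sym e))
    atomic-into-⊗ (at-ᾱ⁻¹ _ _ _) e = ⊥-elim (⊗≢⊙ (sym e))
    atomic-into-⊗ (at-δˡ _ _ _)  e = ⊥-elim (⊗≢⊙ (sym e))
    atomic-into-⊗ (at-δʳ _ _ _)  e = ⊥-elim (⊗≢⊙ (sym e))
    atomic-into-⊗ (at-⊙ˡ _ _)    e = ⊥-elim (⊗≢⊙ (sym e))
    atomic-into-⊗ (at-⊙ʳ _ _)    e = ⊥-elim (⊗≢⊙ (sym e))

    id∘atomic : ∀ {L R X Y} {h : Hom X Y} → AtomicInto⊗ h → (e : Y ≡ L ⊗ R) →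
                IdAnalysis (id ∘ subst (Hom X) e h)
    id∘atomic (α-atom X Y Z) e with ⊗-injective e | e
    ... | refl , refl | refl =
      analysis-via (trans (identityˡ _) (sym (◁-id X Y Z))) (analysis-◁ X (analysis-τ [] []))
    id∘atomic (α⁻¹-atom X Y Z) e with ⊗-injective e | e
    ... | refl , refl | refl =
      analysis-via (trans (identityˡ _) (sym (▷-id X Y Z))) (analysis-▷ Z (analysis-τ [] []))
    id∘atomic (⊗ˡ-atom {f = f} _ _) e with ⊗-injective e | e
    ... | refl , refl | refl =
      analysis-via (trans (identityˡ _) (sym (identityʳ _))) (analysis-⊗∘ f id (analysis-τ [] []))
    id∘atomic (⊗ʳ-atom {f = f} _ _) e with ⊗-injective e | e
    ... | refl , refl | refl =
      analysis-via (trans (identityˡ _) (sym (identityʳ _))) (analysis-⊗∘ id f (analysis-τ [] []))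

    ◁τ∘α⁻¹ : ∀ {L R} u As {X Y Z} (e : X ⊗ (Y ⊗ Z) ≡ X ⊗ Hⁱ L R u As) →
             IdAnalysis ((X ◁ τⁱ u As) ∘ subst (Hom ((X ⊗ Y) ⊗ Z)) e (α⁻¹ X Y Z))
    ◁τ∘α⁻¹ [] [] e with ⊗-injective (proj₂ (⊗-injective e)) | e
    ... | refl , refl | refl =
      analysis-via (trans (cong (_∘ α⁻¹ _ _ _) (◁-id _ _ _)) (α-isoʳ _ _ _)) (analysis-τ [] [])
    ◁τ∘α⁻¹ (aα ∷ u) (A ∷ As) {X} e with ⊗-injective (proj₂ (⊗-injective e)) | e
    ... | refl , refl | refl =
      analysis-via (◁◁-∘-α⁻¹ X A (τⁱ u As)) (analysis-⊗∘ _ id (analysis-◁ (X ⊗ A) (analysis-τ u As)))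
    ◁τ∘α⁻¹ (aα⁻¹ ∷ u) As {X} e with ⊗-injective (proj₂ (⊗-injective e)) | e
    ... | refl , refl | refl =
      analysis-via (▷◁-∘-α⁻¹ X (τⁱ u (init As)) (last As))
        (analysis-▷ (last As) (analysis-◁ X (analysis-τ u (init As))))

    ▷τ∘α : ∀ {L R} u I {X Y Z} (e : (X ⊗ Y) ⊗ Z ≡ Hⁱ L R u I ⊗ Z) →
           IdAnalysis ((τⁱ u I ▷ Z) ∘ subst (Hom (X ⊗ (Y ⊗ Z))) e (α X Y Z))
    ▷τ∘α [] [] e with ⊗-injective (proj₁ (⊗-injective e)) | e
    ... | refl , refl | refl =
      analysis-via (trans (cong (_∘ α _ _ _) (▷-id _ _ _)) (α-isoˡ _ _ _)) (analysis-τ [] [])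
    ▷τ∘α (aα ∷ u) (A ∷ I) {Z = Z} e with ⊗-injective (proj₁ (⊗-injective e)) | e
    ... | refl , refl | refl =
      analysis-via (◁▷-∘-α A (τⁱ u I) Z) (analysis-◁ A (analysis-▷ Z (analysis-τ u I)))
    ▷τ∘α (aα⁻¹ ∷ u) I {Z = Z} e with ⊗-injective (proj₁ (⊗-injective e)) | e
    ... | refl , refl | refl =
      analysis-via (▷▷-∘-α (τⁱ u (init I)) (last I) Z)
        (analysis-⊗∘ id _ (analysis-▷ (last I ⊗ Z) (analysis-τ u (init I))))

    mutual
      τ∘atomic : ∀ {L R} u As {X Y} {h : Hom X Y} → Atomic 𝒞 h → (e : Y ≡ Hⁱ L R u As) →
                 IdAnalysis (τⁱ u As ∘ subst (Hom X) e h)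
      τ∘atomic []         []       a e = id∘atomic (atomic-into-⊗ a e) e
      τ∘atomic (aα ∷ u)   (A ∷ As) a e = ◁τ∘atomic u As (atomic-into-⊗ a e) e
      τ∘atomic (aα⁻¹ ∷ u) As       a e = ▷τ∘atomic u (init As) (atomic-into-⊗ a e) e

      ◁τ∘atomic : ∀ {L R} u As {A X Y} {h : Hom X Y} → AtomicInto⊗ h → (e : Y ≡ A ⊗ Hⁱ L R u As) →
                  IdAnalysis ((A ◁ τⁱ u As) ∘ subst (Hom X) e h)
      ◁τ∘atomic u As (α-atom X Y Z) e with ⊗-injective e | e
      ... | refl , refl | refl =
        analysis-via (◁-∘-α X Y (τⁱ u As))
          (analysis-⊗∘ _ id (analysis-◁ X (analysis-◁ Y (analysis-τ u As))))
      ◁τ∘atomic u As (α⁻¹-atom _ _ _) e with ⊗-injective e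
      ... | refl , _ = ◁τ∘α⁻¹ u As e
      ◁τ∘atomic u As (⊗ˡ-atom {f = f} _ _) e with ⊗-injective e | e
      ... | refl , refl | refl =
        analysis-via (◁-∘-⊗id f) (analysis-⊗∘ _ id (analysis-◁ _ (analysis-τ u As)))
      ◁τ∘atomic u As (⊗ʳ-atom {f = f} _ f-atomic) e with ⊗-injective e | e
      ... | refl , refl | refl =
        analysis-via (◁-∘-id⊗ f) (analysis-◁ _ (τ∘atomic u As f-atomic refl))

      ▷τ∘atomic : ∀ {L R} u I {Z X Y} {h : Hom X Y} → AtomicInto⊗ h → (e : Y ≡ Hⁱ L R u I ⊗ Z) →
                  IdAnalysis ((τⁱ u I ▷ Z) ∘ subst (Hom X) e h)
      ▷τ∘atomic u I (α-atom _ _ _) e with ⊗-injective e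
      ... | _ , refl = ▷τ∘α u I e
      ▷τ∘atomic u I (α⁻¹-atom X Y Z) e with ⊗-injective e | e
      ... | refl , refl | refl =
        analysis-via (▷-∘-α⁻¹ (τⁱ u I) Y Z)
          (analysis-⊗∘ id _ (analysis-▷ Z (analysis-▷ Y (analysis-τ u I))))
      ▷τ∘atomic u I (⊗ˡ-atom {f = f} _ f-atomic) e with ⊗-injective e | e
      ... | refl , refl | refl =
        analysis-via (▷-∘-⊗id f) (analysis-▷ _ (τ∘atomic u I f-atomic refl))
      ▷τ∘atomic u I (⊗ʳ-atom {f = f} _ _) e with ⊗-injective e | e
      ... | refl , refl | refl =
        analysis-via (▷-∘-id⊗ f) (analysis-⊗∘ id _ (analysis-▷ _ (analysis-τ u I)))

open LDCat using (Obj; Hom; id; _∘_; _⊗_)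

lemma4p6 : ∀ {o m : Level} (𝒞 : LDCat o m) → Tidy 𝒞 →
    (u : 𝔜) (As : Vec (Obj 𝒞) (length u)) (L R : Obj 𝒞) →
    ∀ {X : Obj 𝒞} (h : Hom 𝒞 X (Hᵘ 𝒞 (_⊗_ 𝒞 L R) L R u As)) → Atomic 𝒞 h →
    Analysable 𝒞 (Id⊗ 𝒞) (_∘_ 𝒞 (τ 𝒞 (id 𝒞 {_⊗_ 𝒞 L R}) u As) h)
lemma4p6 𝒞 (⊗-injective , _ , ⊗≢⊙) u As L R h h-atomic =
  IdAnalyses.analysable 𝒞 (AtomicComposites.τ∘atomic 𝒞 ⊗-injective ⊗≢⊙ u As h-atomic refl)
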